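{- Let $S=[Y;S_\alpha;\psi_{\alpha,\beta}]$ be a countable strong semilattice of semigroups such that every $\psi_{\alpha,\beta}$ is an isomorphism. If, for some $\alpha\in Y$, $S_\alpha$ is $\aleph_0$-categorical and $Y$ is $\aleph_0$-categorical, then $S$ is $\aleph_0$-categorical. Moreover, if $S$ is automorphism-pure and $\aleph_0$-categorical, then $Y$ and each $S_\alpha$ are $\aleph_0$-categorical.
   Context: A countable structure is $\aleph_0$-categorical iff its automorphism group has finitely many orbits on $n$-tuples for each $n\ge1$. A strong semilattice of semigroups $[Y;S_\alpha;\psi_{\alpha,\beta}]$: $Y$ a semilattice, pairwise disjoint semigroups $S_\alpha$, homomorphisms $\psi_{\alpha,\beta}:S_\alpha\to S_\beta$ ($\alpha\ge\beta$), $\psi_{\alpha,\alpha}=\mathrm{id}$, $\psi_{\alpha,\beta}\psi_{\beta,\gamma}=\psi_{\alpha,\gamma}$, product $a*b=(a\psi_{\alpha,\alpha\beta})(b\psi_{\beta,\alpha\beta})$. Given $\pi\in\mathrm{Aut}(Y)$ and isomorphisms $\theta_\alpha:S_\alpha\to S_{\alpha\pi}$ with $\psi_{\alpha,\beta}\theta_\beta=\theta_\alpha\psi_{\alpha\pi,\beta\pi}$ for all $\alpha\ge\beta$, $\bigcup_\alpha\theta_\alpha$ is an automorphism of $S$; $S$ is automorphism-pure if all automorphisms arise in this way. -}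

module Defs where

open import Data.Nat using (ℕ; _≤_)
open import Data.Fin using (Fin)
open import Data.List using (List)
open import Data.List.Membership.Propositional using (_∈_)
open import Data.Product using (Σ; ∃; _×_; _,_; proj₁; proj₂)
open import Relation.Binary.PropositionalEquality using (_≡_; refl; sym; trans; cong)
open import Function.Definitions using (Injective)

IsAutomorphism : (A : Set) → (A → A → A) → (A → A) → Set
IsAutomorphism A _·_ f =
  (Σ (A → A) λ g → (∀ x → g (f x) ≡ x) × (∀ y → f (g y) ≡ y))
  × (∀ x y → f (x · y) ≡ f x · f y)

IsIsomorphism : (A B : Set) → (A → A → A) → (B → B → B) → (A → B) → Set
IsIsomorphism A B _·_ _∙_ f =
  (Σ (B → A) λ g → (∀ x → g (f x) ≡ x) × (∀ y → f (g y) ≡ y))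
  × (∀ x y → f (x · y) ≡ f x ∙ f y)

Countable : Set → Set
Countable A = Σ (A → ℕ) λ f → Injective _≡_ _≡_ f

FinitelyManyOrbits : (A : Set) → (A → A → A) → ℕ → Set
FinitelyManyOrbits A _·_ n =
  Σ (List (Fin n → A)) λ reps →
    ∀ (t : Fin n → A) → ∃ λ r → r ∈ reps ×
      (Σ (A → A) λ f → IsAutomorphism A _·_ f × (∀ i → f (r i) ≡ t i))

-- ℵ₀-categorical countable structure (Ryll-Nardzewski characterisation,
-- as in the paper's context).
Aleph0Categorical : (A : Set) → (A → A → A) → Set
Aleph0Categorical A _·_ =
  Countable A × (∀ n → 1 ≤ n → FinitelyManyOrbits A _·_ n)

record StrongSemilattice : Set₁ where
  field
    Y        : Set
    _∧_      : Y → Y → Y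
    ∧-assoc  : ∀ α β γ → (α ∧ β) ∧ γ ≡ α ∧ (β ∧ γ)
    ∧-comm   : ∀ α β → α ∧ β ≡ β ∧ α
    ∧-idem   : ∀ α → α ∧ α ≡ α

  _≼_ : Y → Y → Set
  β ≼ α = α ∧ β ≡ β

  field
    -- the (nonempty) semigroups S_α, pairwise disjoint via the Σ-encoding
    S        : Y → Set
    point    : ∀ α → S α
    op       : ∀ α → S α → S α → S α
    op-assoc : ∀ α x y z → op α (op α x y) z ≡ op α x (op α y z)
    ψ        : ∀ α β → β ≼ α → S α → S β
    ψ-hom    : ∀ α β (p : β ≼ α) x y →
               ψ α β p (op α x y) ≡ op β (ψ α β p x) (ψ α β p y)
    ψ-id     : ∀ α (p : α ≼ α) x → ψ α α p x ≡ x
    ψ-comp   : ∀ α β γ (p : β ≼ α) (q : γ ≼ β) (r : γ ≼ α) x →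
               ψ β γ q (ψ α β p x) ≡ ψ α γ r x

  meet≼ˡ : ∀ α β → (α ∧ β) ≼ α
  meet≼ˡ α β = trans (sym (∧-assoc α α β)) (cong (_∧ β) (∧-idem α))

  meet≼ʳ : ∀ α β → (α ∧ β) ≼ β
  meet≼ʳ α β =
    trans (∧-comm β (α ∧ β))
      (trans (∧-assoc α β β) (cong (α ∧_) (∧-idem β)))

  Carrier : Set
  Carrier = Σ Y S

  _*_ : Carrier → Carrier → Carrier
  (α , a) * (β , b) =
    (α ∧ β) , op (α ∧ β) (ψ α (α ∧ β) (meet≼ˡ α β) a)
                         (ψ β (α ∧ β) (meet≼ʳ α β) b)

  AllψIso : Set
  AllψIso = ∀ α β (p : β ≼ α) → IsIsomorphism (S α) (S β) (op α) (op β) (ψ α β p)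

  AutomorphismPure : Set
  AutomorphismPure =
    ∀ (φ : Carrier → Carrier) → IsAutomorphism Carrier _*_ φ →
      Σ (Y → Y) λ π → IsAutomorphism Y _∧_ π ×
      Σ (∀ α → S α → S (π α)) λ θ →
        (∀ α → IsIsomorphism (S α) (S (π α)) (op α) (op (π α)) (θ α)) ×
        (∀ α β (p : β ≼ α) (p' : π β ≼ π α) (a : S α) →
           θ β (ψ α β p a) ≡ ψ (π α) (π β) p' (θ α a)) ×
        (∀ α (a : S α) → φ (α , a) ≡ (π α , θ α a))

-- When every ψ_{α,β} is an isomorphism, all fibres are isomorphic
-- to a fixed one T = S_{α₀} through e_α = ψ_{α₀,α∧α₀}⁻¹ ∘ ψ_{α,α∧α₀}, and
-- these identifications commute with the structure maps
-- (e_β ∘ ψ_{α,β} = e_α).  Hence (α , a) ↦ (α , e_α a) is an isomorphism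
-- S ≅ Y × T onto the direct product.
--
-- Part 1 then follows from two general facts about "finitely many orbits
-- on n-tuples": it is invariant under isomorphism, and it is preserved by
-- direct products (using product automorphisms f × g).
--
-- Part 2 uses a general descent lemma: orbits on n-tuples of A give
-- orbits on n-tuples of B as soon as every automorphism of A moving a
-- tuple into the image of an embedding B → A induces an automorphism of
-- B.  Automorphism-purity supplies the induced automorphisms: π for Y,
-- and e_α⁻¹ ∘ e_{πβ} ∘ θ_β ∘ e_β⁻¹ for the fibre S_α.  Countability of Y
-- and S_α is inherited from S along injections.
module Submission where

open import Defs
open import Data.Product using (Σ; ∃; _×_; _,_; proj₁; proj₂)
open import Data.Nat using (ℕ; suc)
open import Data.Fin using (Fin; zero)
open import Data.List using (List; map; cartesianProductWith)
open import Data.List.Membership.Propositional using (_∈_)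
open import Data.List.Membership.Propositional.Properties
  using (∈-map⁺; ∈-cartesianProductWith⁺)
open import Function.Definitions using (Injective)
open import Relation.Binary.PropositionalEquality

record Iso {A B : Set} (_·_ : A → A → A) (_∙_ : B → B → B) : Set where
  field
    to        : A → B
    from      : B → A
    from∘to   : ∀ x → from (to x) ≡ x
    to∘from   : ∀ y → to (from y) ≡ y
    to-hom    : ∀ x y → to (x · y) ≡ to x ∙ to y

open Iso

fromIsIsomorphism : ∀ {A B : Set} {_·_ : A → A → A} {_∙_ : B → B → B} {f : A → B} →
                    IsIsomorphism A B _·_ _∙_ f → Iso _·_ _∙_
fromIsIsomorphism {f = f} ((g , gf , fg) , h) =
  record { to = f ; from = g ; from∘to = gf ; to∘from = fg ; to-hom = h }

autIso : ∀ {A : Set} {_·_ : A → A → A} {f : A → A} → IsAutomorphism A _·_ f → Iso _·_ _·_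
autIso = fromIsIsomorphism

isoAut : ∀ {A : Set} {_·_ : A → A → A} (i : Iso _·_ _·_) → IsAutomorphism A _·_ (to i)
isoAut i = (from i , from∘to i , to∘from i) , to-hom i

isoSym : ∀ {A B : Set} {_·_ : A → A → A} {_∙_ : B → B → B} →
         Iso _·_ _∙_ → Iso _∙_ _·_
isoSym {_·_ = _·_} {_∙_} i = record
  { to = from i ; from = to i ; from∘to = to∘from i ; to∘from = from∘to i
  ; to-hom = from-hom }
  where
  open ≡-Reasoning
  from-hom : ∀ u v → from i (u ∙ v) ≡ from i u · from i v
  from-hom u v = begin
    from i (u ∙ v)                                ≡⟨ cong (from i) (cong₂ _∙_ (sym (to∘from i u)) (sym (to∘from i v))) ⟩
    from i (to i (from i u) ∙ to i (from i v))    ≡⟨ cong (from i) (sym (to-hom i _ _)) ⟩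
    from i (to i (from i u · from i v))           ≡⟨ from∘to i _ ⟩
    from i u · from i v                           ∎

isoComp : ∀ {A B C : Set} {_·_ : A → A → A} {_∙_ : B → B → B} {_○_ : C → C → C} →
          Iso _·_ _∙_ → Iso _∙_ _○_ → Iso _·_ _○_
isoComp i j = record
  { to      = λ x → to j (to i x)
  ; from    = λ z → from i (from j z)
  ; from∘to = λ x → trans (cong (from i) (from∘to j (to i x))) (from∘to i x)
  ; to∘from = λ z → trans (cong (to j) (to∘from i (from j z))) (to∘from j z)
  ; to-hom  = λ x y → trans (cong (to j) (to-hom i x y)) (to-hom j _ _) }

aut-injective : ∀ {A : Set} {_·_ : A → A → A} (i : Iso _·_ _·_) → Injective _≡_ _≡_ (to i)
aut-injective i {x} {y} eq = trans (sym (from∘to i x)) (trans (cong (from i) eq) (from∘to i y))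

countable-injection : ∀ {A B : Set} (f : B → A) → Injective _≡_ _≡_ f →
                      Countable A → Countable B
countable-injection f f-inj (c , c-inj) = (λ b → c (f b)) , λ eq → f-inj (c-inj eq)

InOrbitOf : ∀ {n} (A : Set) → (A → A → A) → List (Fin n → A) → (Fin n → A) → Set
InOrbitOf A _·_ reps t =
  ∃ λ r → r ∈ reps × (Σ (A → A) λ f → IsAutomorphism A _·_ f × (∀ i → f (r i) ≡ t i))

-- Transport of orbits along an isomorphism: conjugate the automorphisms.
orbits-iso : ∀ {A B : Set} {_·_ : A → A → A} {_∙_ : B → B → B} n →
             Iso _·_ _∙_ → FinitelyManyOrbits A _·_ n → FinitelyManyOrbits B _∙_ n
orbits-iso {A} {B} {_·_} {_∙_} n i (reps , cover) = reps′ , cover′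
  where
  reps′ : List (Fin n → B)
  reps′ = map (λ r k → to i (r k)) reps
  cover′ : ∀ t → InOrbitOf B _∙_ reps′ t
  cover′ t with cover (λ k → from i (t k))
  ... | r , r∈ , f , f-aut , f-r =
    (λ k → to i (r k)) , ∈-map⁺ _ r∈ , to conj , isoAut conj , conj-r
    where
    F : Iso _·_ _·_
    F = autIso f-aut
    -- i ∘ f ∘ i⁻¹
    conj : Iso _∙_ _∙_
    conj = isoComp (isoSym i) (isoComp F i)
    open ≡-Reasoning
    conj-r : ∀ k → to conj (to i (r k)) ≡ t k
    conj-r k = begin
      to i (f (from i (to i (r k))))   ≡⟨ cong (λ x → to i (f x)) (from∘to i (r k)) ⟩
      to i (f (r k))                   ≡⟨ cong (to i) (f-r k) ⟩
      to i (from i (t k))              ≡⟨ to∘from i (t k) ⟩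
      t k                              ∎

_⊗_ : ∀ {A B : Set} → (A → A → A) → (B → B → B) → (A × B → A × B → A × B)
(_·_ ⊗ _∙_) (a , b) (a′ , b′) = (a · a′) , (b ∙ b′)

iso-product : ∀ {A B : Set} {_·_ : A → A → A} {_∙_ : B → B → B} →
              Iso _·_ _·_ → Iso _∙_ _∙_ → Iso (_·_ ⊗ _∙_) (_·_ ⊗ _∙_)
iso-product f g = record
  { to      = λ { (a , b) → to f a , to g b }
  ; from    = λ { (a , b) → from f a , from g b }
  ; from∘to = λ { (a , b) → cong₂ _,_ (from∘to f a) (from∘to g b) }
  ; to∘from = λ { (a , b) → cong₂ _,_ (to∘from f a) (to∘from g b) }
  ; to-hom  = λ { (a , b) (a′ , b′) → cong₂ _,_ (to-hom f a a′) (to-hom g b b′) } }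

-- Finitely many orbits on n-tuples is preserved by direct products:
-- pair up representatives and use product automorphisms.
orbits-product : ∀ {A B : Set} {_·_ : A → A → A} {_∙_ : B → B → B} n →
                 FinitelyManyOrbits A _·_ n → FinitelyManyOrbits B _∙_ n →
                 FinitelyManyOrbits (A × B) (_·_ ⊗ _∙_) n
orbits-product {A} {B} {_·_} {_∙_} n (repsA , coverA) (repsB , coverB) = reps , cover
  where
  pairUp : (Fin n → A) → (Fin n → B) → Fin n → A × B
  pairUp ra rb k = ra k , rb k
  reps : List (Fin n → A × B)
  reps = cartesianProductWith pairUp repsA repsB
  cover : ∀ t → InOrbitOf (A × B) (_·_ ⊗ _∙_) reps t
  cover t with coverA (λ k → proj₁ (t k)) | coverB (λ k → proj₂ (t k))
  ... | ra , ra∈ , f , f-aut , f-ra | rb , rb∈ , g , g-aut , g-rb =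
    pairUp ra rb , ∈-cartesianProductWith⁺ pairUp ra∈ rb∈ , to fg , isoAut fg ,
    λ k → cong₂ _,_ (f-ra k) (g-rb k)
    where
    fg : Iso (_·_ ⊗ _∙_) (_·_ ⊗ _∙_)
    fg = iso-product (autIso f-aut) (autIso g-aut)

InducesAutomorphisms : ∀ {A B : Set} → (A → A → A) → (B → B → B) → ℕ →
                       (B → A) → (A → B) → Set
InducesAutomorphisms {A} {B} _·_ _∙_ n emb proj =
  ∀ (t : Fin n → B) (r : Fin n → A) (φ : A → A) → IsAutomorphism A _·_ φ →
    (∀ k → φ (r k) ≡ emb (t k)) →
    Σ (B → B) λ σ → IsAutomorphism B _∙_ σ × (∀ k → σ (proj (r k)) ≡ t k)

orbits-descend : ∀ {A B : Set} {_·_ : A → A → A} {_∙_ : B → B → B} n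
                 (emb : B → A) (proj : A → B) →
                 InducesAutomorphisms _·_ _∙_ n emb proj →
                 FinitelyManyOrbits A _·_ n → FinitelyManyOrbits B _∙_ n
orbits-descend {A} {B} {_·_} {_∙_} n emb proj induce (reps , cover) = reps′ , cover′
  where
  reps′ : List (Fin n → B)
  reps′ = map (λ r k → proj (r k)) reps
  cover′ : ∀ t → InOrbitOf B _∙_ reps′ t
  cover′ t with cover (λ k → emb (t k))
  ... | r , r∈ , φ , φ-aut , φ-r with induce t r φ φ-aut φ-r
  ...   | σ , σ-aut , σ-r = (λ k → proj (r k)) , ∈-map⁺ _ r∈ , σ , σ-aut , σ-r

module _ (SS : StrongSemilattice) (allIso : StrongSemilattice.AllψIso SS) where
  open StrongSemilattice SS

  ≼-trans : ∀ {α β γ} → α ≼ β → β ≼ γ → α ≼ γ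
  ≼-trans {α} {β} {γ} p q =
    trans (cong (γ ∧_) (sym p)) (trans (sym (∧-assoc γ β α)) (trans (cong (_∧ α) q) p))

  ≼-glb : ∀ {α β γ} → α ≼ β → α ≼ γ → α ≼ (β ∧ γ)
  ≼-glb {α} {β} {γ} p q = trans (∧-assoc β γ α) (trans (cong (β ∧_) q) p)

  Ψ : ∀ α β → β ≼ α → Iso (op α) (op β)
  Ψ α β p = fromIsIsomorphism (allIso α β p)

  module Trivialisation (α₀ : Y) where
    e : ∀ α → Iso (op α) (op α₀)
    e α = isoComp (Ψ α (α ∧ α₀) (meet≼ˡ α α₀)) (isoSym (Ψ α₀ (α ∧ α₀) (meet≼ʳ α α₀)))

    -- The identifications e_α commute with the structure maps; both sides
    -- are compared after mapping down to S_{γ∧α₀}.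
    e-compat : ∀ α γ (p : γ ≼ α) a → to (e γ) (ψ α γ p a) ≡ to (e α) a
    e-compat α γ p a = trans (cong (from Jγ) down) (from∘to Jγ x)
      where
      Jγ : Iso (op α₀) (op (γ ∧ α₀))
      Jγ = Ψ α₀ (γ ∧ α₀) (meet≼ʳ γ α₀)
      Jα : Iso (op α₀) (op (α ∧ α₀))
      Jα = Ψ α₀ (α ∧ α₀) (meet≼ʳ α α₀)
      x : S α₀
      x = from Jα (ψ α (α ∧ α₀) (meet≼ˡ α α₀) a)
      γα₀≼α : (γ ∧ α₀) ≼ α
      γα₀≼α = ≼-trans (meet≼ˡ γ α₀) p
      γα₀≼αα₀ : (γ ∧ α₀) ≼ (α ∧ α₀)
      γα₀≼αα₀ = ≼-glb γα₀≼α (meet≼ʳ γ α₀)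
      open ≡-Reasoning
      down : ψ γ (γ ∧ α₀) (meet≼ˡ γ α₀) (ψ α γ p a) ≡ ψ α₀ (γ ∧ α₀) (meet≼ʳ γ α₀) x
      down = begin
        ψ γ (γ ∧ α₀) _ (ψ α γ p a)
          ≡⟨ ψ-comp α γ (γ ∧ α₀) p (meet≼ˡ γ α₀) γα₀≼α a ⟩
        ψ α (γ ∧ α₀) γα₀≼α a
          ≡⟨ sym (ψ-comp α (α ∧ α₀) (γ ∧ α₀) (meet≼ˡ α α₀) γα₀≼αα₀ γα₀≼α a) ⟩
        ψ (α ∧ α₀) (γ ∧ α₀) γα₀≼αα₀ (ψ α (α ∧ α₀) _ a)
          ≡⟨ cong (ψ (α ∧ α₀) (γ ∧ α₀) γα₀≼αα₀) (sym (to∘from Jα _)) ⟩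
        ψ (α ∧ α₀) (γ ∧ α₀) γα₀≼αα₀ (ψ α₀ (α ∧ α₀) _ x)
          ≡⟨ ψ-comp α₀ (α ∧ α₀) (γ ∧ α₀) (meet≼ʳ α α₀) γα₀≼αα₀ (meet≼ʳ γ α₀) x ⟩
        ψ α₀ (γ ∧ α₀) _ x
          ∎

    coord : Carrier → S α₀
    coord (γ , a) = to (e γ) a

    trivialise : Iso _*_ (_∧_ ⊗ op α₀)
    trivialise = record
      { to      = λ u → proj₁ u , coord u
      ; from    = λ { (γ , x) → γ , from (e γ) x }
      ; from∘to = λ { (γ , a) → cong (γ ,_) (from∘to (e γ) a) }
      ; to∘from = λ { (γ , x) → cong (γ ,_) (to∘from (e γ) x) }
      ; to-hom  = λ { (γ , a) (δ , b) → cong ((γ ∧ δ) ,_)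
          (trans (to-hom (e (γ ∧ δ)) _ _)
                 (cong₂ (op α₀) (e-compat γ (γ ∧ δ) (meet≼ˡ γ δ) a)
                                (e-compat δ (γ ∧ δ) (meet≼ʳ γ δ) b))) } }

  -- Part 1: S ≅ Y × S_{α₀}, and the right-hand side has finitely many orbits.
  categorical-from-base : (Σ Y λ α → Aleph0Categorical (S α) (op α)) →
                          Aleph0Categorical Y _∧_ → Countable Carrier →
                          Aleph0Categorical Carrier _*_
  categorical-from-base (α₀ , _ , orbitsT) (_ , orbitsY) countable =
    countable , λ n n≥1 →
      orbits-iso n (isoSym trivialise) (orbits-product n (orbitsY n n≥1) (orbitsT n n≥1))
    where open Trivialisation α₀

  module _ (pure : AutomorphismPure) where

    -- An automorphism of S acts on Y through π: the semilattice component
    -- of a tuple of S is moved exactly by π.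
    induced-on-Y : ∀ n → InducesAutomorphisms _*_ _∧_ n (λ γ → γ , point γ) proj₁
    induced-on-Y n t r φ φ-aut φ-r with pure φ φ-aut
    ... | π , π-aut , _ , _ , _ , φ-eq =
      π , π-aut , λ k → cong proj₁ (trans (sym (φ-eq _ _)) (φ-r k))

    -- An automorphism of S carrying a tuple r of S onto a tuple of S_α
    -- acts on the (common) fibre S_β of r by θ_β : S_β ≅ S_α; read in the
    -- coordinates of S_α this is an automorphism of S_α.
    induced-on-fibre : ∀ α m →
      InducesAutomorphisms _*_ (op α) (suc m) (λ a → α , a) (Trivialisation.coord α)
    induced-on-fibre α m t r φ φ-aut φ-r with pure φ φ-aut
    ... | π , π-aut , θ , θ-iso , _ , φ-eq = to σ , isoAut σ , σ-r
      where
      open Trivialisation α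
      β : Y
      β = proj₁ (r zero)
      σ : Iso (op α) (op α)
      σ = isoComp (isoSym (e β)) (isoComp (fromIsIsomorphism (θ-iso β))
                  (isoComp (e (π β)) (isoSym (e α))))
      -- the action of φ on elements of S
      Θ : Carrier → Carrier
      Θ (γ , a) = π γ , θ γ a
      lands : ∀ k → Θ (r k) ≡ (α , t k)
      lands k = trans (sym (φ-eq _ _)) (φ-r k)
      same-fibre : ∀ k → proj₁ (r k) ≡ β
      same-fibre k = aut-injective (autIso π-aut)
        (trans (cong proj₁ (lands k)) (sym (cong proj₁ (lands zero))))
      θ-in-coords : ∀ u → proj₁ u ≡ β →
                    to (e (π β)) (θ β (from (e β) (coord u))) ≡ coord (Θ u)
      θ-in-coords (γ , a) refl = cong (λ z → to (e (π γ)) (θ γ z)) (from∘to (e γ) a)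
      open ≡-Reasoning
      σ-r : ∀ k → to σ (coord (r k)) ≡ t k
      σ-r k = begin
        from (e α) (to (e (π β)) (θ β (from (e β) (coord (r k)))))
          ≡⟨ cong (from (e α)) (θ-in-coords (r k) (same-fibre k)) ⟩
        from (e α) (coord (Θ (r k)))
          ≡⟨ cong (λ u → from (e α) (coord u)) (lands k) ⟩
        from (e α) (to (e α) (t k))
          ≡⟨ from∘to (e α) (t k) ⟩
        t k
          ∎

    -- Part 2: Y and every S_α inherit countability along injections and
    -- finitely many orbits by descent from S (for S_α, n ≥ 1 is needed to
    -- name the fibre of a representative).
    categorical-components : Aleph0Categorical Carrier _*_ →
      Aleph0Categorical Y _∧_ × (∀ α → Aleph0Categorical (S α) (op α))
    categorical-components (countable , orbits) =
      (countable-injection (λ γ → γ , point γ) (cong proj₁) countable ,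
       λ n n≥1 → orbits-descend n (λ γ → γ , point γ) proj₁ (induced-on-Y n) (orbits n n≥1)) ,
      λ α → countable-injection (λ a → α , a) (fibre-injective α) countable ,
            λ { (suc m) n≥1 → orbits-descend (suc m) (λ a → α , a) (Trivialisation.coord α)
                  (induced-on-fibre α m) (orbits (suc m) n≥1) }
      where
      fibre-injective : ∀ α → Injective _≡_ _≡_ (λ (a : S α) → (α , a))
      fibre-injective α refl = refl

corollary4p11 :
    (T : StrongSemilattice) →
    let open StrongSemilattice T in
    Countable Carrier →
    AllψIso →
    ((Σ Y λ α → Aleph0Categorical (S α) (op α)) →
       Aleph0Categorical Y _∧_ →
       Aleph0Categorical Carrier _*_)
    ×
    (AutomorphismPure →
       Aleph0Categorical Carrier _*_ →
       Aleph0Categorical Y _∧_ × (∀ α → Aleph0Categorical (S α) (op α)))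
corollary4p11 T countable allIso =
  (λ base-cat Y-cat → categorical-from-base T allIso base-cat Y-cat countable) ,
  categorical-components T allIso
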